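{- For every integer $k\ge1$, $$z_{2k+1}=(x_1^{ -1}x_4y_1)\,z_{2k}+(x_1^{ -1}x_2)\,z_{2k-1},\qquad z_{2k+2}=(x_2^{ -1}x_3)\,z_{2k+1}+(x_1x_2^{ -1}y_1y_2)\,z_{2k}.$$
   Context: Let $x_1,x_2,x_3,x_4,y_1,y_2$ be indeterminates. For $m\ge1$ let $H_m$ be the ladder graph with vertices $A_0,\dots,A_m,B_0,\dots,B_m$ and edges $A_iB_i$ ($0\le i\le m$), $A_iA_{i+1}$, $B_iB_{i+1}$ ($0\le i\le m-1$), with weights: $A_iB_i$ has weight $x_3$ if $i$ is even and $x_4$ if $i$ is odd; $A_iA_{i+1}$ and $B_iB_{i+1}$ have weight $x_2$ if $i$ is even and $x_1$ if $i$ is odd. (This is the snake graph of the arcs of the annulus with one marked point on each boundary component, triangulation $T=\{\tau_1,\tau_2\}$, boundary arcs $\tau_3,\tau_4$, possibly with its top tile removed.) For $1\le j\le m$ let $S_j$ be the square with vertices $A_{j-1},B_{j-1},A_j,B_j$. For a perfect matching $P$ of $H_m$, $w(P)$ is the product of the weights of its edges. Let $P_-$ be the perfect matching of $H_m$ consisting of the edges $A_{2i}A_{2i+1},B_{2i}B_{2i+1}$ for all $i$ with $2i+1\le m$, together with $A_mB_m$ if $m$ is even. The symmetric difference $(P_-\cup P)\setminus(P_-\cap P)$ is the set of boundary edges of a union $\bigcup_{j\in J}S_j$ of squares, and $y(P):=\prod_{j\in J}y_{c(j)}$ where $c(j)=1$ if $j$ is odd and $c(j)=2$ if $j$ is even.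 Define, for $n\ge1$, $$z_{2n-1}=\sum_{P}\frac{w(P)y(P)}{x_1^{n}x_2^{n-1}}\ (P\text{ over perfect matchings of }H_{2n-1}),\qquad z_{2n}=\sum_{P}\frac{w(P)y(P)}{x_1^{n}x_2^{n}}\ (P\text{ over perfect matchings of }H_{2n}).$$ -}

module Defs where

open import Level using (Level)
open import Algebra.Bundles using (CommutativeRing)
open import Data.Bool using (Bool; true; false; _∧_; _∨_; _xor_; if_then_else_)
import Data.Bool as Bool
open import Data.Nat using (ℕ; zero; suc; ⌊_/2⌋; ⌈_/2⌉)
import Data.Nat as ℕ
open import Data.Fin using (Fin; zero; suc; inject₁; fromℕ; toℕ)
import Data.Fin as Fin
open import Data.Fin.Properties using (all?)
open import Data.List using (List; []; _∷_; _++_; map; concatMap; foldr; allFin)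
open import Data.Product using (_×_; _,_; proj₁; proj₂)
open import Relation.Nullary using (Dec; yes; no; does; ¬_)
open import Relation.Nullary.Decidable using (_×-dec_)
open import Relation.Binary.PropositionalEquality using (_≡_)

isEven : ℕ → Bool
isEven zero = true
isEven (suc n) = Bool.not (isEven n)

consF : ∀ {n} → Bool → (Fin n → Bool) → Fin (suc n) → Bool
consF b f zero = b
consF b f (suc i) = f i

allSubsets : (n : ℕ) → List (Fin n → Bool)
allSubsets zero = (λ ()) ∷ []
allSubsets (suc n) =
  concatMap (λ f → consF false f ∷ consF true f ∷ []) (allSubsets n)

countᵇ : ∀ {a} {A : Set a} → (A → Bool) → List A → ℕ
countᵇ p [] = 0
countᵇ p (x ∷ xs) = (if p x then 1 else 0) ℕ.+ countᵇ p xs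

data Vtx (m : ℕ) : Set where
  A B : Fin (suc m) → Vtx m

-- edges: rung i = A_i B_i ; top i = A_i A_{i+1} ; bot i = B_i B_{i+1}
data Edge (m : ℕ) : Set where
  rung : Fin (suc m) → Edge m
  top bot : Fin m → Edge m

allEdges : (m : ℕ) → List (Edge m)
allEdges m = map rung (allFin (suc m)) ++ map top (allFin m) ++ map bot (allFin m)

eqVᵇ : ∀ {m} → Vtx m → Vtx m → Bool
eqVᵇ (A i) (A j) = does (i Fin.≟ j)
eqVᵇ (B i) (B j) = does (i Fin.≟ j)
eqVᵇ _ _ = false

endpoints : ∀ {m} → Edge m → Vtx m × Vtx m
endpoints (rung i) = A i , B i
endpoints (top i) = A (inject₁ i) , A (suc i)
endpoints (bot i) = B (inject₁ i) , B (suc i)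

incidentᵇ : ∀ {m} → Vtx m → Edge m → Bool
incidentᵇ v e = eqVᵇ v (proj₁ (endpoints e)) ∨ eqVᵇ v (proj₂ (endpoints e))

EdgeSet : ℕ → Set
EdgeSet m = (Fin (suc m) → Bool) × (Fin m → Bool) × (Fin m → Bool)

_∋ᵇ_ : ∀ {m} → EdgeSet m → Edge m → Bool
(r , t , b) ∋ᵇ rung i = r i
(r , t , b) ∋ᵇ top i = t i
(r , t , b) ∋ᵇ bot i = b i

allEdgeSets : (m : ℕ) → List (EdgeSet m)
allEdgeSets m =
  concatMap (λ r → concatMap (λ t → map (λ b → r , t , b) (allSubsets m))
                             (allSubsets m))
            (allSubsets (suc m))

degree : ∀ {m} → EdgeSet m → Vtx m → ℕ
degree {m} P v = countᵇ (λ e → (P ∋ᵇ e) ∧ incidentᵇ v e) (allEdges m)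

IsPerfectMatching : ∀ {m} → EdgeSet m → Set
IsPerfectMatching P = ∀ v → degree P v ≡ 1

-- squares: for j : Fin m, sq j is S_{j+1} with vertices A_j,B_j,A_{j+1},B_{j+1};
-- its edges are rung j, rung (j+1), top j, bot j.
inSquareᵇ : ∀ {m} → Fin m → Edge m → Bool
inSquareᵇ j (rung i) = does (i Fin.≟ inject₁ j) ∨ does (i Fin.≟ suc j)
inSquareᵇ j (top i) = does (i Fin.≟ j)
inSquareᵇ j (bot i) = does (i Fin.≟ j)

-- boundary of the union of the squares in J (J ⊆ {S_1..S_m}):
-- the edges lying in exactly one square of J
boundaryᵇ : ∀ {m} → (Fin m → Bool) → Edge m → Bool
boundaryᵇ {m} J e = countᵇ (λ j → J j ∧ inSquareᵇ j e) (allFin m) ℕ.≡ᵇ 1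

Pminus : (m : ℕ) → EdgeSet m
Pminus m = (λ i → does (i Fin.≟ fromℕ m) ∧ isEven m)
         , (λ i → isEven (toℕ i))
         , (λ i → isEven (toℕ i))

SymDiffIsBoundary : ∀ {m} → EdgeSet m → (Fin m → Bool) → Set
SymDiffIsBoundary {m} P J = ∀ e → ((Pminus m ∋ᵇ e) xor (P ∋ᵇ e)) ≡ boundaryᵇ J e

decAllV : ∀ {m} {Q : Vtx m → Set} → (∀ v → Dec (Q v)) → Dec (∀ v → Q v)
decAllV d with all? (λ i → d (A i)) | all? (λ i → d (B i))
... | yes a | yes b = yes (λ { (A i) → a i ; (B i) → b i })
... | no ¬a | _ = no (λ h → ¬a (λ i → h (A i)))
... | yes _ | no ¬b = no (λ h → ¬b (λ i → h (B i)))

decAllE : ∀ {m} {Q : Edge m → Set} → (∀ e → Dec (Q e)) → Dec (∀ e → Q e)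
decAllE d with all? (λ i → d (rung i)) | all? (λ i → d (top i)) | all? (λ i → d (bot i))
... | yes a | yes b | yes c = yes (λ { (rung i) → a i ; (top i) → b i ; (bot i) → c i })
... | no ¬a | _ | _ = no (λ h → ¬a (λ i → h (rung i)))
... | yes _ | no ¬b | _ = no (λ h → ¬b (λ i → h (top i)))
... | yes _ | yes _ | no ¬c = no (λ h → ¬c (λ i → h (bot i)))

isPerfectMatching? : ∀ {m} (P : EdgeSet m) → Dec (IsPerfectMatching P)
isPerfectMatching? P = decAllV (λ v → degree P v ℕ.≟ 1)

symDiffIsBoundary? : ∀ {m} (P : EdgeSet m) (J : Fin m → Bool) → Dec (SymDiffIsBoundary P J)
symDiffIsBoundary? {m} P J = decAllE (λ e → ((Pminus m ∋ᵇ e) xor (P ∋ᵇ e)) Bool.≟ boundaryᵇ J e)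

-- Weights and the elements z_n, in a commutative ring R with
-- x1, x2 invertible (inverses x1inv, x2inv).

module Snake {c ℓ : Level} (R : CommutativeRing c ℓ)
             (x1 x1inv x2 x2inv x3 x4 y1 y2 : CommutativeRing.Carrier R) where
  open CommutativeRing R

  sumL : ∀ {a} {X : Set a} → List X → (X → Carrier) → Carrier
  sumL xs f = foldr (λ x acc → f x + acc) 0# xs

  prodL : ∀ {a} {X : Set a} → List X → (X → Carrier) → Carrier
  prodL xs f = foldr (λ x acc → f x * acc) 1# xs

  pow : Carrier → ℕ → Carrier
  pow a zero = 1#
  pow a (suc n) = a * pow a n

  wt : ∀ {m} → Edge m → Carrier
  wt (rung i) = if isEven (toℕ i) then x3 else x4
  wt (top i) = if isEven (toℕ i) then x2 else x1
  wt (bot i) = if isEven (toℕ i) then x2 else x1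

  w : ∀ {m} → EdgeSet m → Carrier
  w {m} P = prodL (allEdges m) (λ e → if P ∋ᵇ e then wt e else 1#)

  -- y(J) = ∏_{j∈J} y_{c(j)}; Fin index j stands for square S_{j+1},
  -- so c = 1 iff j+1 odd iff toℕ j even
  yJ : ∀ {m} → (Fin m → Bool) → Carrier
  yJ {m} J = prodL (allFin m)
               (λ j → if J j then (if isEven (toℕ j) then y1 else y2) else 1#)

  -- Σ_{P perfect matching of H_m} w(P) y(P), where y(P) = y(J) for the
  -- (unique) J with  P_- ⊖ P = boundary(⋃_{j∈J} S_j)
  matchingSum : ℕ → Carrier
  matchingSum m =
    sumL (allEdgeSets m) (λ P →
      sumL (allSubsets m) (λ J →
        if does (isPerfectMatching? P ×-dec symDiffIsBoundary? P J)
        then w P * yJ J else 0#))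

  -- z_N = matchingSum N / (x1^⌈N/2⌉ x2^⌊N/2⌋), i.e.
  -- z_{2n-1} = .../(x1^n x2^(n-1)),  z_{2n} = .../(x1^n x2^n)
  z : ℕ → Carrier
  z N = matchingSum N * (pow x1inv ⌈ N /2⌉ * pow x2inv ⌊ N /2⌋)

-- A perfect matching P of H_m is determined by the set t of squares whose two horizontal edges
-- it uses: P₋ ⊖ P bounds ⋃_{j∈J} S_j exactly for J = t ⊕ (squares used by P₋), and P is perfect
-- iff no two squares of t are adjacent. The matching sum is therefore a sum over such t of a
-- weight that factors square by square, which peeling off the first square turns into a
-- recursion along the ladder. The recurrences of the theorem peel off the last square instead;
-- they follow by induction because the two linear recursions commute, with coefficients the
-- weights of the last two squares, which depend only on the parity of m. Finally the powers of
-- x₁⁻¹, x₂⁻¹ in z are absorbed using x₁x₁⁻¹ = x₂x₂⁻¹ = 1.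

module Submission where

open import Defs
open import Level using (Level)
open import Algebra.Bundles using (CommutativeRing)
open import Data.Nat using (ℕ; zero; suc; _≤_; ⌊_/2⌋; ⌈_/2⌉)
import Data.Nat as ℕ
import Data.Nat.Properties as ℕ
open import Data.Bool using (Bool; true; false; not; _∧_; _∨_; _xor_; if_then_else_; T)
import Data.Bool.Properties as Bool
open import Data.Fin using (Fin; zero; suc; inject₁; fromℕ; toℕ)
import Data.Fin as Fin
import Data.Fin.Properties as Fin
open import Data.List using (List; []; _∷_; _++_; map; concatMap; allFin)
import Data.List.Properties as List
open import Data.Product using (Σ; _×_; _,_; proj₁; proj₂)
open import Data.Sum using (_⊎_; inj₁; inj₂)
open import Function using (_∘_; id; _⇔_; mk⇔; Equivalence)
open import Relation.Nullary using (¬_; does)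
open import Relation.Nullary.Decidable using (does-⇔; T?; dec-true; dec-false; _×-dec_)
open import Relation.Binary.PropositionalEquality
  using (_≡_; _≗_; refl; sym; trans; cong; cong₂; subst; module ≡-Reasoning)

[_] : Bool → ℕ
[ b ] = if b then 1 else 0

parity : ∀ {n} → Fin n → Bool
parity i = isEven (toℕ i)

_⊕_ : ∀ {n} → (Fin n → Bool) → (Fin n → Bool) → Fin n → Bool
(f ⊕ g) i = f i xor g i

xor-interchange : ∀ a b c d → not (a xor b) xor (c xor d) ≡ not ((a xor d) xor (b xor c))
xor-interchange a b c d = begin
  not (a xor b) xor (c xor d)   ≡⟨ sym (Bool.not-distribˡ-xor (a xor b) (c xor d)) ⟩
  not ((a xor b) xor (c xor d)) ≡⟨ cong not (Bool.xor-assoc a b (c xor d)) ⟩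
  not (a xor (b xor (c xor d))) ≡⟨ cong (λ x → not (a xor x)) (sym (Bool.xor-assoc b c d)) ⟩
  not (a xor ((b xor c) xor d)) ≡⟨ cong (λ x → not (a xor x)) (Bool.xor-comm (b xor c) d) ⟩
  not (a xor (d xor (b xor c))) ≡⟨ cong not (sym (Bool.xor-assoc a d (b xor c))) ⟩
  not ((a xor d) xor (b xor c)) ∎
  where open ≡-Reasoning

xor-cancelˡ : ∀ a x → a xor (a xor x) ≡ x
xor-cancelˡ a x = trans (sym (Bool.xor-assoc a a x)) (cong (_xor x) (Bool.xor-same a))

-- Whether the square left (resp. right) of rung i lies in t; q stands in for the missing square
-- left of rung 0.
before : ∀ {n} → Bool → (Fin n → Bool) → Fin (suc n) → Bool
before q t zero    = q
before q t (suc i) = t i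

after : ∀ {n} → (Fin n → Bool) → Fin (suc n) → Bool
after {zero}  t zero    = false
after {suc n} t zero    = t zero
after {suc n} t (suc i) = after (t ∘ suc) i

before-shift : ∀ {n} (t : Fin (suc n) → Bool) i → before (t zero) (t ∘ suc) i ≡ t i
before-shift t zero    = refl
before-shift t (suc i) = refl

before-⊕ : ∀ {n} (f g : Fin n → Bool) i → before false (f ⊕ g) i ≡ before false f i xor before false g i
before-⊕ f g zero    = refl
before-⊕ f g (suc i) = refl

after-⊕ : ∀ {n} (f g : Fin n → Bool) i → after (f ⊕ g) i ≡ after f i xor after g i
after-⊕ {zero}  f g zero    = refl
after-⊕ {suc n} f g zero    = refl
after-⊕ {suc n} f g (suc i) = after-⊕ (f ∘ suc) (g ∘ suc) i

after-last : ∀ {n} (t : Fin n → Bool) → after t (fromℕ n) ≡ false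
after-last {zero}  t = refl
after-last {suc n} t = after-last (t ∘ suc)

after-inject₁ : ∀ {n} (t : Fin n → Bool) i → after t (inject₁ i) ≡ t i
after-inject₁ t zero    = refl
after-inject₁ t (suc i) = after-inject₁ (t ∘ suc) i

before-parity-last : ∀ n → before false parity (fromℕ n) ≡ not (isEven n)
before-parity-last zero    = refl
before-parity-last (suc n) =
  trans (cong isEven (Fin.toℕ-fromℕ n)) (sym (Bool.not-involutive (isEven n)))

before-parity-inject₁ : ∀ {n} (i : Fin n) → before false parity (inject₁ i) ≡ not (parity i)
before-parity-inject₁ zero    = refl
before-parity-inject₁ (suc i) =
  trans (cong isEven (Fin.toℕ-inject₁ i)) (sym (Bool.not-involutive (parity i)))

last-or-inject₁ : ∀ {n} (i : Fin (suc n)) → i ≡ fromℕ n ⊎ Σ (Fin n) (λ j → i ≡ inject₁ j)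
last-or-inject₁ {zero}  zero = inj₁ refl
last-or-inject₁ {suc n} zero = inj₂ (zero , refl)
last-or-inject₁ {suc n} (suc i) with last-or-inject₁ i
... | inj₁ eq       = inj₁ (cong suc eq)
... | inj₂ (j , eq) = inj₂ (suc j , cong suc eq)

Pminus-rung : ∀ m i → Pminus m ∋ᵇ rung i ≡ not (before false parity i xor after parity i)
Pminus-rung m i with last-or-inject₁ i
... | inj₁ refl
  rewrite dec-true (fromℕ m Fin.≟ fromℕ m) refl | before-parity-last m | after-last (parity {m})
        | Bool.xor-identityʳ (not (isEven m)) = sym (Bool.not-involutive (isEven m))
... | inj₂ (j , refl)
  rewrite dec-false (inject₁ j Fin.≟ fromℕ m) (Fin.fromℕ≢inject₁ ∘ sym)
        | before-parity-inject₁ j | after-inject₁ parity j = cong not (sym (Bool.xor-inverseˡ (parity j)))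

module _ {a} {A : Set a} where

  count-cong : ∀ {p q : A → Bool} xs → p ≗ q → countᵇ p xs ≡ countᵇ q xs
  count-cong []       h = refl
  count-cong (x ∷ xs) h = cong₂ (λ b n → [ b ] ℕ.+ n) (h x) (count-cong xs h)

  count-++ : ∀ (p : A → Bool) xs ys → countᵇ p (xs ++ ys) ≡ countᵇ p xs ℕ.+ countᵇ p ys
  count-++ p []       ys = refl
  count-++ p (x ∷ xs) ys =
    trans (cong ([ p x ] ℕ.+_) (count-++ p xs ys)) (sym (ℕ.+-assoc [ p x ] _ _))

  count-none : ∀ {p : A → Bool} xs → (∀ x → p x ≡ false) → countᵇ p xs ≡ 0
  count-none []       h = refl
  count-none (x ∷ xs) h rewrite h x = count-none xs h

count-map : ∀ {a b} {A : Set a} {B : Set b} (p : B → Bool) (f : A → B) xs →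
            countᵇ p (map f xs) ≡ countᵇ (p ∘ f) xs
count-map p f []       = refl
count-map p f (x ∷ xs) = cong ([ p (f x) ] ℕ.+_) (count-map p f xs)

allFin-suc : ∀ n → allFin (suc n) ≡ zero ∷ map suc (allFin n)
allFin-suc n = cong (zero ∷_) (sym (List.map-tabulate id suc))

count-allFin-suc : ∀ {n} (p : Fin (suc n) → Bool) →
                   countᵇ p (allFin (suc n)) ≡ [ p zero ] ℕ.+ countᵇ (p ∘ suc) (allFin n)
count-allFin-suc {n} p =
  trans (cong (countᵇ p) (allFin-suc n)) (cong ([ p zero ] ℕ.+_) (count-map p suc (allFin n)))

count-at : ∀ {n} (f : Fin n → Bool) i → countᵇ (λ j → f j ∧ does (i Fin.≟ j)) (allFin n) ≡ [ f i ]
count-at {suc n} f zero = begin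
  countᵇ (λ j → f j ∧ does (zero Fin.≟ j)) (allFin (suc n)) ≡⟨ count-allFin-suc (λ j → f j ∧ does (zero Fin.≟ j)) ⟩
  [ f zero ∧ true ] ℕ.+ countᵇ (λ j → f (suc j) ∧ false) (allFin n)
    ≡⟨ cong₂ (λ b n → [ b ] ℕ.+ n) (Bool.∧-identityʳ (f zero)) (count-none (allFin n) (λ j → Bool.∧-zeroʳ (f (suc j)))) ⟩
  [ f zero ] ℕ.+ 0                                       ≡⟨ ℕ.+-identityʳ _ ⟩
  [ f zero ]                                             ∎
  where open ≡-Reasoning
count-at {suc n} f (suc i) = begin
  countᵇ (λ j → f j ∧ does (suc i Fin.≟ j)) (allFin (suc n)) ≡⟨ count-allFin-suc (λ j → f j ∧ does (suc i Fin.≟ j)) ⟩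
  [ f zero ∧ false ] ℕ.+ countᵇ (λ j → f (suc j) ∧ does (i Fin.≟ j)) (allFin n)
    ≡⟨ cong (λ b → [ b ] ℕ.+ countᵇ (λ j → f (suc j) ∧ does (i Fin.≟ j)) (allFin n)) (Bool.∧-zeroʳ (f zero)) ⟩
  countᵇ (λ j → f (suc j) ∧ does (i Fin.≟ j)) (allFin n) ≡⟨ count-at (f ∘ suc) i ⟩
  [ f (suc i) ]                                            ∎
  where open ≡-Reasoning

count-adjacent : ∀ {n} (f : Fin n → Bool) i →
  countᵇ (λ j → f j ∧ (does (i Fin.≟ inject₁ j) ∨ does (i Fin.≟ suc j))) (allFin n)
    ≡ [ after f i ] ℕ.+ [ before false f i ]
count-adjacent {zero}  f zero = refl
count-adjacent {suc n} f zero =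
  trans (count-allFin-suc (λ j → f j ∧ (does (zero Fin.≟ inject₁ j) ∨ does (zero Fin.≟ suc j))))
        (cong₂ (λ b m → [ b ] ℕ.+ m) (Bool.∧-identityʳ (f zero))
               (count-none (allFin n) (λ j → Bool.∧-zeroʳ (f (suc j)))))
count-adjacent {suc n} f (suc i) =
  trans (count-allFin-suc (λ j → f j ∧ (does (suc i Fin.≟ inject₁ j) ∨ does (suc i Fin.≟ suc j))))
        (trans (cong ([ f zero ∧ does (i Fin.≟ zero) ] ℕ.+_) (count-adjacent (f ∘ suc) i)) (reindex i))
  where
  reindex : ∀ i → [ f zero ∧ does (i Fin.≟ zero) ] ℕ.+ ([ after (f ∘ suc) i ] ℕ.+ [ before false (f ∘ suc) i ])
                  ≡ [ after (f ∘ suc) i ] ℕ.+ [ f i ]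
  reindex zero    rewrite Bool.∧-identityʳ (f zero) | ℕ.+-identityʳ [ after (f ∘ suc) zero ] = ℕ.+-comm [ f zero ] _
  reindex (suc i) rewrite Bool.∧-zeroʳ (f zero) = refl

degree-A : ∀ {m} (r : Fin (suc m) → Bool) (t b : Fin m → Bool) i →
           degree (r , t , b) (A i) ≡ [ r i ] ℕ.+ ([ after t i ] ℕ.+ [ before false t i ])
degree-A {m} r t b i = begin
  degree (r , t , b) (A i)
    ≡⟨ count-++ p (map rung (allFin (suc m))) (map top (allFin m) ++ map bot (allFin m)) ⟩
  countᵇ p (map rung (allFin (suc m))) ℕ.+ countᵇ p (map top (allFin m) ++ map bot (allFin m))
    ≡⟨ cong₂ ℕ._+_ rungs (count-++ p (map top (allFin m)) (map bot (allFin m))) ⟩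
  [ r i ] ℕ.+ (countᵇ p (map top (allFin m)) ℕ.+ countᵇ p (map bot (allFin m)))
    ≡⟨ cong ([ r i ] ℕ.+_) (cong₂ ℕ._+_ (trans (count-map p top (allFin m)) (count-adjacent t i))
                                         (trans (count-map p bot (allFin m))
                                                (count-none (allFin m) (λ j → Bool.∧-zeroʳ (b j))))) ⟩
  [ r i ] ℕ.+ (([ after t i ] ℕ.+ [ before false t i ]) ℕ.+ 0)
    ≡⟨ cong ([ r i ] ℕ.+_) (ℕ.+-identityʳ _) ⟩
  [ r i ] ℕ.+ ([ after t i ] ℕ.+ [ before false t i ]) ∎
  where
  open ≡-Reasoning
  p = λ e → ((r , t , b) ∋ᵇ e) ∧ incidentᵇ (A i) e
  rungs : countᵇ p (map rung (allFin (suc m))) ≡ [ r i ]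
  rungs = trans (count-map p rung (allFin (suc m)))
                (trans (count-cong (allFin (suc m)) (λ j → cong (r j ∧_) (Bool.∨-identityʳ _)))
                       (count-at r i))

degree-B : ∀ {m} (r : Fin (suc m) → Bool) (t b : Fin m → Bool) i →
           degree (r , t , b) (B i) ≡ [ r i ] ℕ.+ ([ after b i ] ℕ.+ [ before false b i ])
degree-B {m} r t b i = begin
  degree (r , t , b) (B i)
    ≡⟨ count-++ p (map rung (allFin (suc m))) (map top (allFin m) ++ map bot (allFin m)) ⟩
  countᵇ p (map rung (allFin (suc m))) ℕ.+ countᵇ p (map top (allFin m) ++ map bot (allFin m))
    ≡⟨ cong₂ ℕ._+_ (trans (count-map p rung (allFin (suc m))) (count-at r i))
                   (count-++ p (map top (allFin m)) (map bot (allFin m))) ⟩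
  [ r i ] ℕ.+ (countᵇ p (map top (allFin m)) ℕ.+ countᵇ p (map bot (allFin m)))
    ≡⟨ cong ([ r i ] ℕ.+_) (cong₂ ℕ._+_ (trans (count-map p top (allFin m))
                                                (count-none (allFin m) (λ j → Bool.∧-zeroʳ (t j))))
                                         (trans (count-map p bot (allFin m)) (count-adjacent b i))) ⟩
  [ r i ] ℕ.+ ([ after b i ] ℕ.+ [ before false b i ]) ∎
  where
  open ≡-Reasoning
  p = λ e → ((r , t , b) ∋ᵇ e) ∧ incidentᵇ (B i) e

boundary-rung : ∀ {m} (J : Fin m → Bool) i → boundaryᵇ J (rung i) ≡ after J i xor before false J i
boundary-rung J i rewrite count-adjacent J i = exactly-one (after J i) (before false J i)
  where
  exactly-one : ∀ a b → ([ a ] ℕ.+ [ b ] ℕ.≡ᵇ 1) ≡ a xor b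
  exactly-one true  true  = refl
  exactly-one true  false = refl
  exactly-one false true  = refl
  exactly-one false false = refl

boundary-side : ∀ {m} (J : Fin m → Bool) i → boundaryᵇ J (top i) ≡ J i
boundary-side J i rewrite count-at J i = one (J i)
  where
  one : ∀ a → ([ a ] ℕ.≡ᵇ 1) ≡ a
  one true  = refl
  one false = refl

-- Rung i is used iff its neighbouring squares are both in t or both not (for sparse t only the
-- latter occurs); this form makes symDiff⇔ hold for every J.
matchingOf : ∀ {m} → (Fin m → Bool) → EdgeSet m
matchingOf t = (λ i → not (before false t i xor after t i)) , t , t

sparse : ∀ {n} → Bool → (Fin n → Bool) → Bool
sparse {zero}  q t = true
sparse {suc n} q t = not (q ∧ t zero) ∧ sparse (t zero) (t ∘ suc)

sparse⇒ : ∀ {n} q (t : Fin n → Bool) → T (sparse q t) → ∀ i → before q t i ∧ after t i ≡ false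
sparse⇒ {zero}  q t _ zero    = Bool.∧-zeroʳ q
sparse⇒ {suc n} q t s zero    = Equivalence.to Bool.T-not-≡ (proj₁ (Equivalence.to Bool.T-∧ s))
sparse⇒ {suc n} q t s (suc i) =
  trans (cong (_∧ after (t ∘ suc) i) (sym (before-shift t i)))
        (sparse⇒ (t zero) (t ∘ suc) (proj₂ (Equivalence.to Bool.T-∧ s)) i)

sparse⇐ : ∀ {n} q (t : Fin n → Bool) → (∀ i → before q t i ∧ after t i ≡ false) → T (sparse q t)
sparse⇐ {zero}  q t h = _
sparse⇐ {suc n} q t h = Equivalence.from Bool.T-∧
  ( Equivalence.from Bool.T-not-≡ (h zero)
  , sparse⇐ (t zero) (t ∘ suc) (λ i → trans (cong (_∧ after (t ∘ suc) i) (before-shift t i)) (h (suc i))))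

one-edge-at-rung : ∀ a b → [ not (a xor b) ] ℕ.+ ([ b ] ℕ.+ [ a ]) ≡ 1 ⇔ a ∧ b ≡ false
one-edge-at-rung true  true  = mk⇔ (λ ()) (λ ())
one-edge-at-rung true  false = mk⇔ (λ _ → refl) (λ _ → refl)
one-edge-at-rung false true  = mk⇔ (λ _ → refl) (λ _ → refl)
one-edge-at-rung false false = mk⇔ (λ _ → refl) (λ _ → refl)

does-isPerfectMatching?-matchingOf : ∀ {m} (t : Fin m → Bool) →
                               does (isPerfectMatching? (matchingOf t)) ≡ sparse false t
does-isPerfectMatching?-matchingOf t = does-⇔ (mk⇔ to from) (isPerfectMatching? (matchingOf t)) (T? (sparse false t))
  where
  r = proj₁ (matchingOf t)
  to : IsPerfectMatching (matchingOf t) → T (sparse false t)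
  to pm = sparse⇐ false t (λ i →
    Equivalence.to (one-edge-at-rung (before false t i) (after t i)) (trans (sym (degree-A r t t i)) (pm (A i))))
  from : T (sparse false t) → IsPerfectMatching (matchingOf t)
  from s (A i) = trans (degree-A r t t i)
    (Equivalence.from (one-edge-at-rung (before false t i) (after t i)) (sparse⇒ false t s i))
  from s (B i) = trans (degree-B r t t i)
    (Equivalence.from (one-edge-at-rung (before false t i) (after t i)) (sparse⇒ false t s i))

_≐_ : ∀ {m} → EdgeSet m → EdgeSet m → Set
P ≐ Q = ∀ e → P ∋ᵇ e ≡ Q ∋ᵇ e

Pminus-xor-boundary : ∀ {m} (J : Fin m → Bool) e →
                      (Pminus m ∋ᵇ e) xor boundaryᵇ J e ≡ matchingOf (parity ⊕ J) ∋ᵇ e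
Pminus-xor-boundary {m} J (rung i) = begin
  (Pminus m ∋ᵇ rung i) xor boundaryᵇ J (rung i)
    ≡⟨ cong₂ _xor_ (Pminus-rung m i) (boundary-rung J i) ⟩
  not (before false parity i xor after parity i) xor (after J i xor before false J i)
    ≡⟨ xor-interchange (before false parity i) (after parity i) (after J i) (before false J i) ⟩
  not ((before false parity i xor before false J i) xor (after parity i xor after J i))
    ≡⟨ cong not (sym (cong₂ _xor_ (before-⊕ parity J i) (after-⊕ parity J i))) ⟩
  not (before false (parity ⊕ J) i xor after (parity ⊕ J) i) ∎
  where open ≡-Reasoning
Pminus-xor-boundary J (top i) = cong (parity i xor_) (boundary-side J i)
Pminus-xor-boundary J (bot i) = cong (parity i xor_) (boundary-side J i)

symDiff⇔ : ∀ {m} (P : EdgeSet m) J → SymDiffIsBoundary P J ⇔ P ≐ matchingOf (parity ⊕ J)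
symDiff⇔ {m} P J = mk⇔
  (λ sd e → trans (sym (xor-cancelˡ (Pminus m ∋ᵇ e) (P ∋ᵇ e)))
                  (trans (cong ((Pminus m ∋ᵇ e) xor_) (sd e)) (Pminus-xor-boundary J e)))
  (λ eq e → trans (cong ((Pminus m ∋ᵇ e) xor_) (trans (eq e) (sym (Pminus-xor-boundary J e))))
                  (xor-cancelˡ (Pminus m ∋ᵇ e) (boundaryᵇ J e)))

≐-sym : ∀ {m} {P Q : EdgeSet m} → P ≐ Q → Q ≐ P
≐-sym eq e = sym (eq e)

≐-components : ∀ {m} {r r' : Fin (suc m) → Bool} {t t' b b' : Fin m → Bool} →
               r ≗ r' → t ≗ t' → b ≗ b' → (r , t , b) ≐ (r' , t' , b')
≐-components r≗ t≗ b≗ (rung i) = r≗ i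
≐-components r≗ t≗ b≗ (top i)  = t≗ i
≐-components r≗ t≗ b≗ (bot i)  = b≗ i

≐-perfect : ∀ {m} {P Q : EdgeSet m} → P ≐ Q → IsPerfectMatching P → IsPerfectMatching Q
≐-perfect {m} eq pm v = trans (count-cong (allEdges m) (λ e → cong (_∧ incidentᵇ v e) (sym (eq e)))) (pm v)

≐-symDiff : ∀ {m} {P Q : EdgeSet m} {J} → P ≐ Q → SymDiffIsBoundary P J → SymDiffIsBoundary Q J
≐-symDiff {m} eq sd e = trans (cong ((Pminus m ∋ᵇ e) xor_) (sym (eq e))) (sd e)

isEven-double : ∀ j → isEven (j ℕ.+ j) ≡ true
isEven-double zero    = refl
isEven-double (suc j) =
  trans (cong (not ∘ isEven) (ℕ.+-suc j j)) (trans (Bool.not-involutive (isEven (j ℕ.+ j))) (isEven-double j))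

⌊+double/2⌋ : ∀ i j → ⌊ i ℕ.+ (j ℕ.+ j) /2⌋ ≡ ⌊ i /2⌋ ℕ.+ j
⌊+double/2⌋ zero          j = sym (ℕ.n≡⌊n+n/2⌋ j)
⌊+double/2⌋ (suc zero)    j = sym (ℕ.n≡⌈n+n/2⌉ j)
⌊+double/2⌋ (suc (suc i)) j = cong suc (⌊+double/2⌋ i j)

2*suc≡2+double : ∀ j → 2 ℕ.* suc j ≡ 2 ℕ.+ (j ℕ.+ j)
2*suc≡2+double j = cong suc (trans (ℕ.+-suc j (j ℕ.+ 0)) (cong (λ x → suc (j ℕ.+ x)) (ℕ.+-identityʳ j)))

module Ladder {c ℓ : Level} (R : CommutativeRing c ℓ)
              (x1 x1inv x2 x2inv x3 x4 y1 y2 : CommutativeRing.Carrier R) where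

  open CommutativeRing R hiding (zero) renaming (refl to ≈-refl; sym to ≈-sym; trans to ≈-trans)
  open Snake R x1 x1inv x2 x2inv x3 x4 y1 y2
  open import Algebra.Solver.Ring.NaturalCoefficients.Default commutativeSemiring
    using (solve; _:+_; _:*_; _:=_)
  open import Relation.Binary.Reasoning.Setoid setoid

  module _ {a} {X : Set a} where

    sumL-cong : ∀ xs {f g : X → Carrier} → (∀ x → f x ≈ g x) → sumL xs f ≈ sumL xs g
    sumL-cong []       h = ≈-refl
    sumL-cong (x ∷ xs) h = +-cong (h x) (sumL-cong xs h)

    sumL-++ : ∀ xs ys (f : X → Carrier) → sumL (xs ++ ys) f ≈ sumL xs f + sumL ys f
    sumL-++ []       ys f = ≈-sym (+-identityˡ _)
    sumL-++ (x ∷ xs) ys f = ≈-trans (+-congˡ (sumL-++ xs ys f)) (≈-sym (+-assoc _ _ _))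

    sumL-zero : ∀ xs {f : X → Carrier} → (∀ x → f x ≈ 0#) → sumL xs f ≈ 0#
    sumL-zero []       h = ≈-refl
    sumL-zero (x ∷ xs) h = ≈-trans (+-cong (h x) (sumL-zero xs h)) (+-identityˡ 0#)

    sumL-+ : ∀ xs (f g : X → Carrier) → sumL xs (λ x → f x + g x) ≈ sumL xs f + sumL xs g
    sumL-+ []       f g = ≈-sym (+-identityˡ 0#)
    sumL-+ (x ∷ xs) f g = ≈-trans (+-congˡ (sumL-+ xs f g))
      (solve 4 (λ a b c d → (a :+ b) :+ (c :+ d) := (a :+ c) :+ (b :+ d)) ≈-refl (f x) (g x) (sumL xs f) (sumL xs g))

    sumL-*ˡ : ∀ xs a (f : X → Carrier) → sumL xs (λ x → a * f x) ≈ a * sumL xs f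
    sumL-*ˡ []       a f = ≈-sym (zeroʳ a)
    sumL-*ˡ (x ∷ xs) a f = ≈-trans (+-congˡ (sumL-*ˡ xs a f)) (≈-sym (distribˡ a _ _))

    prodL-cong : ∀ xs {f g : X → Carrier} → f ≗ g → prodL xs f ≡ prodL xs g
    prodL-cong xs h = List.foldr-cong (λ x y → cong (_* y) (h x)) refl xs

    prodL-++ : ∀ xs ys (f : X → Carrier) → prodL (xs ++ ys) f ≈ prodL xs f * prodL ys f
    prodL-++ []       ys f = ≈-sym (*-identityˡ _)
    prodL-++ (x ∷ xs) ys f = ≈-trans (*-congˡ (prodL-++ xs ys f)) (≈-sym (*-assoc _ _ _))

  sumL-map : ∀ {a b} {X : Set a} {Y : Set b} (g : X → Y) xs (f : Y → Carrier) →
             sumL (map g xs) f ≡ sumL xs (f ∘ g)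
  sumL-map g xs f = List.foldr-map _ g 0# xs

  prodL-map : ∀ {a b} {X : Set a} {Y : Set b} (g : X → Y) xs (f : Y → Carrier) →
              prodL (map g xs) f ≡ prodL xs (f ∘ g)
  prodL-map g xs f = List.foldr-map _ g 1# xs

  sumL-concatMap : ∀ {a b} {X : Set a} {Y : Set b} (g : X → List Y) xs (f : Y → Carrier) →
                   sumL (concatMap g xs) f ≈ sumL xs (λ x → sumL (g x) f)
  sumL-concatMap g []       f = ≈-refl
  sumL-concatMap g (x ∷ xs) f = ≈-trans (sumL-++ (g x) (concatMap g xs) f) (+-congˡ (sumL-concatMap g xs f))

  sumL-swap : ∀ {a b} {X : Set a} {Y : Set b} xs ys (f : X → Y → Carrier) →
              sumL xs (λ x → sumL ys (f x)) ≈ sumL ys (λ y → sumL xs (λ x → f x y))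
  sumL-swap []       ys f = ≈-sym (sumL-zero ys (λ _ → ≈-refl))
  sumL-swap (x ∷ xs) ys f =
    ≈-trans (+-congˡ (sumL-swap xs ys f)) (≈-sym (sumL-+ ys (f x) (λ y → sumL xs (λ x → f x y))))

  prodL-allFin-suc : ∀ {n} (f : Fin (suc n) → Carrier) →
                     prodL (allFin (suc n)) f ≡ f zero * prodL (allFin n) (f ∘ suc)
  prodL-allFin-suc {n} f = trans (cong (λ xs → prodL xs f) (allFin-suc n))
                                 (cong (f zero *_) (prodL-map suc (allFin n) f))

  if-cong : ∀ b {x y} → x ≈ y → (if b then x else 0#) ≈ (if b then y else 0#)
  if-cong true  x≈y = x≈y
  if-cong false x≈y = ≈-refl

  sumL-guarded : ∀ {a} {X : Set a} xs b (p : X → Bool) u (g : X → Carrier) →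
    sumL xs (λ x → if b ∧ p x then u * g x else 0#) ≈ (if b then u * sumL xs (λ x → if p x then g x else 0#) else 0#)
  sumL-guarded xs true  p u g = ≈-trans (sumL-cong xs guard) (sumL-*ˡ xs u (λ x → if p x then g x else 0#))
    where
    guard : ∀ x → (if p x then u * g x else 0#) ≈ u * (if p x then g x else 0#)
    guard x with p x
    ... | true  = ≈-refl
    ... | false = ≈-sym (zeroʳ u)
  sumL-guarded xs false p u g = sumL-zero xs (λ _ → ≈-refl)

  sumL-allSubsets-suc : ∀ n (F : (Fin (suc n) → Bool) → Carrier) →
    sumL (allSubsets (suc n)) F ≈ sumL (allSubsets n) (λ f → F (consF false f) + F (consF true f))
  sumL-allSubsets-suc n F =
    ≈-trans (sumL-concatMap (λ f → consF false f ∷ consF true f ∷ []) (allSubsets n) F)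
            (sumL-cong (allSubsets n) (λ f → +-congˡ (+-identityʳ _)))

  pair-collapse : ∀ (h : Bool → Carrier) b → h (not b) ≈ 0# → h false + h true ≈ h b
  pair-collapse h false h≈0 = ≈-trans (+-congˡ h≈0) (+-identityʳ _)
  pair-collapse h true  h≈0 = ≈-trans (+-congʳ h≈0) (+-identityˡ _)

  consF-cong : ∀ {n} b {f g : Fin n → Bool} → f ≗ g → consF b f ≗ consF b g
  consF-cong b f≗g zero    = refl
  consF-cong b f≗g (suc i) = f≗g i

  consF-head-tail : ∀ {n} (g : Fin (suc n) → Bool) → consF (g zero) (g ∘ suc) ≗ g
  consF-head-tail g zero    = refl
  consF-head-tail g (suc i) = refl

  -- Subsets are enumerated as functions, which agree with g₀ only pointwise.
  sumL-allSubsets-single : ∀ n (g₀ : Fin n → Bool) (F : (Fin n → Bool) → Carrier) →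
    (∀ g → ¬ g ≗ g₀ → F g ≈ 0#) → (∀ g g′ → g ≗ g′ → F g ≈ F g′) → sumL (allSubsets n) F ≈ F g₀
  sumL-allSubsets-single zero g₀ F vanish resp = ≈-trans (+-identityʳ _) (resp _ g₀ (λ ()))
  sumL-allSubsets-single (suc n) g₀ F vanish resp = begin
    sumL (allSubsets (suc n)) F
      ≈⟨ sumL-allSubsets-suc n F ⟩
    sumL (allSubsets n) (λ f → F (consF false f) + F (consF true f))
      ≈⟨ sumL-cong (allSubsets n) (λ f → pair-collapse (λ b → F (consF b f)) b₀ (vanish _ (off f))) ⟩
    sumL (allSubsets n) (λ f → F (consF b₀ f))
      ≈⟨ sumL-allSubsets-single n (g₀ ∘ suc) (λ f → F (consF b₀ f))
           (λ g g≉ → vanish _ (λ eq → g≉ (eq ∘ suc)))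
           (λ g g′ g≗g′ → resp _ _ (consF-cong b₀ g≗g′)) ⟩
    F (consF b₀ (g₀ ∘ suc))
      ≈⟨ resp _ g₀ (consF-head-tail g₀) ⟩
    F g₀ ∎
    where
    b₀ = g₀ zero
    off : ∀ f → ¬ consF (not b₀) f ≗ g₀
    off f eq = Bool.not-¬ refl (sym (eq zero))

  sumL-allEdgeSets : ∀ {m} (F : EdgeSet m → Carrier) → sumL (allEdgeSets m) F ≈
    sumL (allSubsets (suc m)) (λ r → sumL (allSubsets m) (λ t → sumL (allSubsets m) (λ b → F (r , t , b))))
  sumL-allEdgeSets {m} F =
    ≈-trans (sumL-concatMap _ (allSubsets (suc m)) F) (sumL-cong (allSubsets (suc m)) (λ r →
    ≈-trans (sumL-concatMap _ (allSubsets m) F) (sumL-cong (allSubsets m) (λ t →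
    reflexive (sumL-map _ (allSubsets m) F)))))

  sumL-allEdgeSets-single : ∀ {m} (P₀ : EdgeSet m) (F : EdgeSet m → Carrier) →
    (∀ P → ¬ P ≐ P₀ → F P ≈ 0#) → (∀ P Q → P ≐ Q → F P ≈ F Q) → sumL (allEdgeSets m) F ≈ F P₀
  sumL-allEdgeSets-single {m} (r₀ , t₀ , b₀) F vanish resp = begin
    sumL (allEdgeSets m) F
      ≈⟨ sumL-allEdgeSets F ⟩
    sumL (allSubsets (suc m)) (λ r → sumL (allSubsets m) (λ t → sumL (allSubsets m) (λ b → F (r , t , b))))
      ≈⟨ sumL-allSubsets-single (suc m) r₀ _
           (λ r r≉ → sumL-zero (allSubsets m) (λ t → sumL-zero (allSubsets m) (λ b →
                       vanish _ (λ eq → r≉ (λ i → eq (rung i))))))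
           (λ r r′ r≗r′ → sumL-cong (allSubsets m) (λ t → sumL-cong (allSubsets m) (λ b →
                       resp _ _ (≐-components r≗r′ (λ _ → refl) (λ _ → refl))))) ⟩
    sumL (allSubsets m) (λ t → sumL (allSubsets m) (λ b → F (r₀ , t , b)))
      ≈⟨ sumL-allSubsets-single m t₀ _
           (λ t t≉ → sumL-zero (allSubsets m) (λ b → vanish _ (λ eq → t≉ (λ i → eq (top i)))))
           (λ t t′ t≗t′ → sumL-cong (allSubsets m) (λ b →
                       resp _ _ (≐-components (λ _ → refl) t≗t′ (λ _ → refl)))) ⟩
    sumL (allSubsets m) (λ b → F (r₀ , t₀ , b))
      ≈⟨ sumL-allSubsets-single m b₀ _
           (λ b b≉ → vanish _ (λ eq → b≉ (λ i → eq (bot i))))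
           (λ b b′ b≗b′ → resp _ _ (≐-components (λ _ → refl) (λ _ → refl) b≗b′)) ⟩
    F (r₀ , t₀ , b₀) ∎

  w-≐ : ∀ {m} {P Q : EdgeSet m} → P ≐ Q → w P ≡ w Q
  w-≐ {m} eq = prodL-cong (allEdges m) (λ e → cong (λ b → if b then wt e else 1#) (eq e))

  matchingTerm : ∀ {m} → (Fin m → Bool) → EdgeSet m → Carrier
  matchingTerm J P = if does (isPerfectMatching? P ×-dec symDiffIsBoundary? P J) then w P * yJ J else 0#

  matchingTerm-≐ : ∀ {m} (J : Fin m → Bool) {P Q} → P ≐ Q → matchingTerm J P ≡ matchingTerm J Q
  matchingTerm-≐ J {P} {Q} eq = cong₂ (λ b x → if b then x * yJ J else 0#)
    (cong₂ _∧_ (does-⇔ (mk⇔ (≐-perfect eq) (≐-perfect (≐-sym eq))) (isPerfectMatching? P) (isPerfectMatching? Q))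
               (does-⇔ (mk⇔ (≐-symDiff eq) (≐-symDiff (≐-sym eq))) (symDiffIsBoundary? P J) (symDiffIsBoundary? Q J)))
    (w-≐ eq)

  matchingTerm-off : ∀ {m} (J : Fin m → Bool) P → ¬ P ≐ matchingOf (parity ⊕ J) → matchingTerm J P ≡ 0#
  matchingTerm-off J P P≉ = cong (λ b → if b then w P * yJ J else 0#)
    (trans (cong (does (isPerfectMatching? P) ∧_)
                 (dec-false (symDiffIsBoundary? P J) (P≉ ∘ Equivalence.to (symDiff⇔ P J))))
           (Bool.∧-zeroʳ _))

  matchingTerm-on : ∀ {m} (J : Fin m → Bool) → let t = parity ⊕ J in
                    matchingTerm J (matchingOf t) ≡ (if sparse false t then w (matchingOf t) * yJ J else 0#)
  matchingTerm-on J = cong (λ b → if b then w (matchingOf t) * yJ J else 0#)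
    (trans (cong₂ _∧_ (does-isPerfectMatching?-matchingOf t)
                      (dec-true (symDiffIsBoundary? (matchingOf t) J)
                                (Equivalence.from (symDiff⇔ (matchingOf t) J) (λ _ → refl))))
           (Bool.∧-identityʳ _))
    where t = parity ⊕ J

  matchingSum-by-subsets : ∀ m → matchingSum m ≈
    sumL (allSubsets m) (λ J → if sparse false (parity ⊕ J) then w (matchingOf (parity ⊕ J)) * yJ J else 0#)
  matchingSum-by-subsets m = begin
    matchingSum m
      ≈⟨ sumL-swap (allEdgeSets m) (allSubsets m) (λ P J → matchingTerm J P) ⟩
    sumL (allSubsets m) (λ J → sumL (allEdgeSets m) (matchingTerm J))
      ≈⟨ sumL-cong (allSubsets m) (λ J → sumL-allEdgeSets-single (matchingOf (parity ⊕ J)) (matchingTerm J)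
           (λ P P≉ → reflexive (matchingTerm-off J P P≉)) (λ P Q eq → reflexive (matchingTerm-≐ J eq))) ⟩
    sumL (allSubsets m) (λ J → matchingTerm J (matchingOf (parity ⊕ J)))
      ≈⟨ sumL-cong (allSubsets m) (λ J → reflexive (matchingTerm-on J)) ⟩
    sumL (allSubsets m) (λ J → if sparse false (parity ⊕ J) then w (matchingOf (parity ⊕ J)) * yJ J else 0#) ∎

  _^?_ : Carrier → Bool → Carrier
  x ^? b = if b then x else 1#

  -- Position-dependent weights: rung k, the horizontal edges and the y-variable of square k
  -- (the paper's S_{k+1}); reference k says whether P₋ uses the horizontal edges of square k.
  record LadderWeights : Set c where
    field
      rungW sideW yW : ℕ → Carrier
      reference      : ℕ → Bool

  open LadderWeights

  shift : LadderWeights → LadderWeights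
  shift L = record
    { rungW = rungW L ∘ suc ; sideW = sideW L ∘ suc ; yW = yW L ∘ suc ; reference = reference L ∘ suc }

  squareW : LadderWeights → ℕ → Bool → Carrier
  squareW L k u = ((sideW L k ^? u) * (sideW L k ^? u)) * (yW L k ^? (reference L k xor u))

  -- w(P) y(P) for the matching with horizontal squares t, with c as in before.
  matchingWeight : ∀ {n} → LadderWeights → Bool → (Fin n → Bool) → Carrier
  matchingWeight {n} L c t =
    (prodL (allFin (suc n)) (λ i → rungW L (toℕ i) ^? not (before c t i xor after t i)) * (sides * sides))
      * prodL (allFin n) (λ i → yW L (toℕ i) ^? (reference L (toℕ i) xor t i))
    where sides = prodL (allFin n) (λ i → sideW L (toℕ i) ^? t i)

  matchingWeight-zero : ∀ L c (t : Fin 0 → Bool) → matchingWeight L c t ≈ rungW L 0 ^? not c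
  matchingWeight-zero L c t = begin
    ((rungW L 0 ^? not (c xor false)) * 1# * (1# * 1#)) * 1#
      ≈⟨ *-identityʳ _ ⟩
    (rungW L 0 ^? not (c xor false)) * 1# * (1# * 1#)
      ≈⟨ ≈-trans (*-congˡ (*-identityʳ 1#)) (≈-trans (*-identityʳ _) (*-identityʳ _)) ⟩
    rungW L 0 ^? not (c xor false)
      ≡⟨ cong (λ b → rungW L 0 ^? not b) (Bool.xor-identityʳ c) ⟩
    rungW L 0 ^? not c ∎

  matchingWeight-suc : ∀ {n} L c (t : Fin (suc n) → Bool) → matchingWeight L c t ≈
    ((rungW L 0 ^? not (c xor t zero)) * squareW L 0 (t zero)) * matchingWeight (shift L) (t zero) (t ∘ suc)
  matchingWeight-suc {n} L c t = begin
    matchingWeight L c t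
      ≡⟨ cong₂ (λ R S → (R * (S * S)) * Y) rungs (prodL-allFin-suc (λ i → sideW L (toℕ i) ^? t i)) ⟩
    ((ρ * R′) * ((s * S′) * (s * S′))) * Y
      ≡⟨ cong (((ρ * R′) * ((s * S′) * (s * S′))) *_)
              (prodL-allFin-suc (λ i → yW L (toℕ i) ^? (reference L (toℕ i) xor t i))) ⟩
    ((ρ * R′) * ((s * S′) * (s * S′))) * (y * Y′)
      ≈⟨ solve 6 (λ ρ R′ s S′ y Y′ → ((ρ :* R′) :* ((s :* S′) :* (s :* S′))) :* (y :* Y′)
                                    := (ρ :* ((s :* s) :* y)) :* ((R′ :* (S′ :* S′)) :* Y′))
               ≈-refl ρ R′ s S′ y Y′ ⟩
    (ρ * ((s * s) * y)) * ((R′ * (S′ * S′)) * Y′) ∎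
    where
    Y  = prodL (allFin (suc n)) (λ i → yW L (toℕ i) ^? (reference L (toℕ i) xor t i))
    ρ  = rungW L 0 ^? not (c xor t zero)
    s  = sideW L 0 ^? t zero
    y  = yW L 0 ^? (reference L 0 xor t zero)
    R′ = prodL (allFin (suc n))
               (λ i → rungW L (suc (toℕ i)) ^? not (before (t zero) (t ∘ suc) i xor after (t ∘ suc) i))
    S′ = prodL (allFin n) (λ i → sideW L (suc (toℕ i)) ^? t (suc i))
    Y′ = prodL (allFin n) (λ i → yW L (suc (toℕ i)) ^? (reference L (suc (toℕ i)) xor t (suc i)))
    rungs : prodL (allFin (suc (suc n))) (λ i → rungW L (toℕ i) ^? not (before c t i xor after t i)) ≡ ρ * R′
    rungs = trans (prodL-allFin-suc (λ i → rungW L (toℕ i) ^? not (before c t i xor after t i)))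
                  (cong (ρ *_) (prodL-cong (allFin (suc n)) (λ i →
                    cong (λ b → rungW L (suc (toℕ i)) ^? not (b xor after (t ∘ suc) i)) (sym (before-shift t i)))))

  -- The horizontal squares of the matching P with P₋ ⊖ P = ∂(⋃_{j∈J} S_j), cf. symDiff⇔.
  twist : ∀ {n} → LadderWeights → (Fin n → Bool) → Fin n → Bool
  twist L J i = reference L (toℕ i) xor J i

  configurationTerm : ∀ {n} → LadderWeights → Bool → (Fin n → Bool) → Carrier
  configurationTerm L c J = if sparse c (twist L J) then matchingWeight L c (twist L J) else 0#

  configurationSum : LadderWeights → Bool → ℕ → Carrier
  configurationSum L c n = sumL (allSubsets n) (configurationTerm L c)

  -- c records that rung 0 is already covered by a square to its left.
  pathSum : LadderWeights → Bool → ℕ → Carrier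
  pathSum L false zero    = rungW L 0
  pathSum L true  zero    = 1#
  pathSum L false (suc n) = (rungW L 0 * squareW L 0 false) * pathSum (shift L) false n
                            + squareW L 0 true * pathSum (shift L) true n
  pathSum L true  (suc n) = squareW L 0 false * pathSum (shift L) false n

  branch : LadderWeights → Bool → Bool → ℕ → Carrier
  branch L c u n =
    if not (c ∧ u) then ((rungW L 0 ^? not (c xor u)) * squareW L 0 u) * configurationSum (shift L) u n else 0#

  configurationSum-consF : ∀ L c n b →
    sumL (allSubsets n) (λ f → configurationTerm L c (consF b f)) ≈ branch L c (reference L 0 xor b) n
  configurationSum-consF L c n b =
    ≈-trans (sumL-cong (allSubsets n) (λ f → if-cong (not (c ∧ u) ∧ sparse u (twist (shift L) f))
                                                      (matchingWeight-suc L c (twist L (consF b f)))))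
            (sumL-guarded (allSubsets n) (not (c ∧ u)) (λ f → sparse u (twist (shift L) f))
                          ((rungW L 0 ^? not (c xor u)) * squareW L 0 u)
                          (λ f → matchingWeight (shift L) u (twist (shift L) f)))
    where u = reference L 0 xor b

  configurationSum≈pathSum : ∀ L c n → configurationSum L c n ≈ pathSum L c n
  configurationSum≈pathSum L c zero = ≈-trans (+-identityʳ _) (≈-trans (matchingWeight-zero L c (λ ())) (empty c))
    where
    empty : ∀ c → rungW L 0 ^? not c ≈ pathSum L c zero
    empty false = ≈-refl
    empty true  = ≈-refl
  configurationSum≈pathSum L c (suc n) = begin
    configurationSum L c (suc n)
      ≈⟨ sumL-allSubsets-suc n (configurationTerm L c) ⟩
    sumL (allSubsets n) (λ f → configurationTerm L c (consF false f) + configurationTerm L c (consF true f))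
      ≈⟨ sumL-+ (allSubsets n) _ _ ⟩
    sumL (allSubsets n) (λ f → configurationTerm L c (consF false f))
      + sumL (allSubsets n) (λ f → configurationTerm L c (consF true f))
      ≈⟨ +-cong (configurationSum-consF L c n false) (configurationSum-consF L c n true) ⟩
    branch L c (reference L 0 xor false) n + branch L c (reference L 0 xor true) n
      ≈⟨ reorder (reference L 0) ⟩
    branch L c false n + branch L c true n
      ≈⟨ branches c ⟩
    pathSum L c (suc n) ∎
    where
    reorder : ∀ r → branch L c (r xor false) n + branch L c (r xor true) n ≈ branch L c false n + branch L c true n
    reorder false = ≈-refl
    reorder true  = +-comm _ _
    branches : ∀ c → branch L c false n + branch L c true n ≈ pathSum L c (suc n)
    branches false = +-cong (*-congˡ (configurationSum≈pathSum (shift L) false n))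
                            (≈-trans (*-congʳ (*-identityˡ _)) (*-congˡ (configurationSum≈pathSum (shift L) true n)))
    branches true  = ≈-trans (+-identityʳ _)
                             (≈-trans (*-congʳ (*-identityˡ _)) (*-congˡ (configurationSum≈pathSum (shift L) false n)))

  backC backD : LadderWeights → ℕ → Carrier
  backC L n = rungW L (suc (suc n)) * squareW L (suc n) false
  backD L n = squareW L (suc n) true * squareW L n false

  -- The defining recursion of pathSum peels off the first square, this one the last.
  pathSum-back : ∀ L c n → pathSum L c (suc (suc n)) ≈ backC L n * pathSum L c (suc n) + backD L n * pathSum L c n
  pathSum-back L false zero = begin
    (ρ₀ * a₀) * ((ρ₁ * a₁) * ρ₂ + b₁ * 1#) + b₀ * (a₁ * ρ₂)
      ≈⟨ +-congʳ (*-congˡ (+-congˡ (*-identityʳ b₁))) ⟩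
    (ρ₀ * a₀) * ((ρ₁ * a₁) * ρ₂ + b₁) + b₀ * (a₁ * ρ₂)
      ≈⟨ solve 7 (λ ρ₀ ρ₁ ρ₂ a₀ a₁ b₀ b₁ →
                    (ρ₀ :* a₀) :* ((ρ₁ :* a₁) :* ρ₂ :+ b₁) :+ b₀ :* (a₁ :* ρ₂)
                 := (ρ₂ :* a₁) :* ((ρ₀ :* a₀) :* ρ₁ :+ b₀) :+ (b₁ :* a₀) :* ρ₀)
               ≈-refl ρ₀ ρ₁ ρ₂ a₀ a₁ b₀ b₁ ⟩
    (ρ₂ * a₁) * ((ρ₀ * a₀) * ρ₁ + b₀) + (b₁ * a₀) * ρ₀
      ≈⟨ +-congʳ (*-congˡ (+-congˡ (≈-sym (*-identityʳ b₀)))) ⟩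
    (ρ₂ * a₁) * ((ρ₀ * a₀) * ρ₁ + b₀ * 1#) + (b₁ * a₀) * ρ₀ ∎
    where
    ρ₀ = rungW L 0
    ρ₁ = rungW L 1
    ρ₂ = rungW L 2
    a₀ = squareW L 0 false
    a₁ = squareW L 1 false
    b₀ = squareW L 0 true
    b₁ = squareW L 1 true
  pathSum-back L true zero =
    solve 6 (λ ρ₁ ρ₂ a₀ a₁ b₁ one →
                a₀ :* ((ρ₁ :* a₁) :* ρ₂ :+ b₁ :* one)
             := (ρ₂ :* a₁) :* (a₀ :* ρ₁) :+ (b₁ :* a₀) :* one)
          ≈-refl (rungW L 1) (rungW L 2) (squareW L 0 false) (squareW L 1 false) (squareW L 1 true) 1#
  pathSum-back L false (suc n) = begin
    a * P (suc (suc n)) + b * Q (suc (suc n))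
      ≈⟨ +-cong (*-congˡ (pathSum-back (shift L) false n)) (*-congˡ (pathSum-back (shift L) true n)) ⟩
    a * (C * P (suc n) + D * P n) + b * (C * Q (suc n) + D * Q n)
      ≈⟨ solve 8 (λ a b C D p₁ p₀ q₁ q₀ →
                    a :* (C :* p₁ :+ D :* p₀) :+ b :* (C :* q₁ :+ D :* q₀)
                 := C :* (a :* p₁ :+ b :* q₁) :+ D :* (a :* p₀ :+ b :* q₀))
               ≈-refl a b C D (P (suc n)) (P n) (Q (suc n)) (Q n) ⟩
    C * (a * P (suc n) + b * Q (suc n)) + D * (a * P n + b * Q n) ∎
    where
    a = rungW L 0 * squareW L 0 false
    b = squareW L 0 true
    C = backC L (suc n)
    D = backD L (suc n)
    P = pathSum (shift L) false
    Q = pathSum (shift L) true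
  pathSum-back L true (suc n) = begin
    a * P (suc (suc n))
      ≈⟨ *-congˡ (pathSum-back (shift L) false n) ⟩
    a * (C * P (suc n) + D * P n)
      ≈⟨ solve 5 (λ a C D p₁ p₀ → a :* (C :* p₁ :+ D :* p₀) := C :* (a :* p₁) :+ D :* (a :* p₀))
               ≈-refl a C D (P (suc n)) (P n) ⟩
    C * (a * P (suc n)) + D * (a * P n) ∎
    where
    a = squareW L 0 false
    C = backC L (suc n)
    D = backD L (suc n)
    P = pathSum (shift L) false

  snakeWeights : LadderWeights
  snakeWeights = record
    { rungW     = λ k → if isEven k then x3 else x4
    ; sideW     = λ k → if isEven k then x2 else x1
    ; yW        = λ k → if isEven k then y1 else y2
    ; reference = isEven
    }

  w-matchingOf : ∀ {m} (J : Fin m → Bool) →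
                 w (matchingOf (parity ⊕ J)) * yJ J ≈ matchingWeight snakeWeights false (parity ⊕ J)
  w-matchingOf {m} J = *-cong edges (reflexive (prodL-cong (allFin m) (λ i →
    cong (yW snakeWeights (toℕ i) ^?_) (sym (xor-cancelˡ (parity i) (J i))))))
    where
    f : Edge m → Carrier
    f e = if matchingOf (parity ⊕ J) ∋ᵇ e then wt e else 1#
    edges : w (matchingOf (parity ⊕ J)) ≈ prodL (allFin (suc m)) (f ∘ rung)
                                          * (prodL (allFin m) (f ∘ top) * prodL (allFin m) (f ∘ bot))
    edges = ≈-trans (prodL-++ (map rung (allFin (suc m))) (map top (allFin m) ++ map bot (allFin m)) f)
                    (*-cong (reflexive (prodL-map rung (allFin (suc m)) f))
                            (≈-trans (prodL-++ (map top (allFin m)) (map bot (allFin m)) f)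
                                     (reflexive (cong₂ _*_ (prodL-map top (allFin m) f) (prodL-map bot (allFin m) f)))))

  matchingSum≈pathSum : ∀ m → matchingSum m ≈ pathSum snakeWeights false m
  matchingSum≈pathSum m = begin
    matchingSum m
      ≈⟨ matchingSum-by-subsets m ⟩
    sumL (allSubsets m) (λ J → if sparse false (parity ⊕ J) then w (matchingOf (parity ⊕ J)) * yJ J else 0#)
      ≈⟨ sumL-cong (allSubsets m) (λ J → if-cong (sparse false (parity ⊕ J)) (w-matchingOf J)) ⟩
    configurationSum snakeWeights false m
      ≈⟨ configurationSum≈pathSum snakeWeights false m ⟩
    pathSum snakeWeights false m ∎

  unit² : ∀ a → (1# * 1#) * a ≈ a
  unit² a = ≈-trans (*-congʳ (*-identityˡ 1#)) (*-identityˡ a)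

  backC-odd : ∀ n → isEven n ≡ false → backC snakeWeights n ≈ x4 * y1
  backC-odd n odd rewrite odd = *-congˡ (unit² y1)

  backD-odd : ∀ n → isEven n ≡ false → backD snakeWeights n ≈ x2 * x2
  backD-odd n odd rewrite odd = ≈-trans (*-cong (*-identityʳ _) (unit² 1#)) (*-identityʳ _)

  backC-even : ∀ n → isEven n ≡ true → backC snakeWeights n ≈ x3
  backC-even n even rewrite even = ≈-trans (*-congˡ (unit² 1#)) (*-identityʳ x3)

  backD-even : ∀ n → isEven n ≡ true → backD snakeWeights n ≈ x1 * x1 * y2 * y1
  backD-even n even rewrite even = *-congˡ (unit² y1)

  matchingSum-back : ∀ n → matchingSum (suc (suc n)) ≈
    backC snakeWeights n * matchingSum (suc n) + backD snakeWeights n * matchingSum n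
  matchingSum-back n = begin
    matchingSum (suc (suc n))
      ≈⟨ matchingSum≈pathSum (suc (suc n)) ⟩
    pathSum snakeWeights false (suc (suc n))
      ≈⟨ pathSum-back snakeWeights false n ⟩
    backC snakeWeights n * pathSum snakeWeights false (suc n) + backD snakeWeights n * pathSum snakeWeights false n
      ≈⟨ ≈-sym (+-cong (*-congˡ (matchingSum≈pathSum (suc n))) (*-congˡ (matchingSum≈pathSum n))) ⟩
    backC snakeWeights n * matchingSum (suc n) + backD snakeWeights n * matchingSum n ∎

  z-offset : ∀ i j → z (i ℕ.+ (j ℕ.+ j)) ≡
    matchingSum (i ℕ.+ (j ℕ.+ j)) * (pow x1inv (⌈ i /2⌉ ℕ.+ j) * pow x2inv (⌊ i /2⌋ ℕ.+ j))
  z-offset i j = cong₂ (λ a b → matchingSum (i ℕ.+ (j ℕ.+ j)) * (pow x1inv a * pow x2inv b))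
                       (⌊+double/2⌋ (suc i) j) (⌊+double/2⌋ i j)

  z-odd : x2 * x2inv ≈ 1# → ∀ j → let d = j ℕ.+ j in
          z (3 ℕ.+ d) ≈ x1inv * x4 * y1 * z (2 ℕ.+ d) + x1inv * x2 * z (1 ℕ.+ d)
  z-odd x2x2inv≈1 j = begin
    z (3 ℕ.+ d)
      ≡⟨ z-offset 3 j ⟩
    M₃ * ((x1inv * (x1inv * p)) * (x2inv * q))
      ≈⟨ *-congʳ (≈-trans (matchingSum-back (suc d)) (+-cong (*-congʳ (backC-odd (suc d) odd))
                                                          (*-congʳ (backD-odd (suc d) odd)))) ⟩
    (x4 * y1 * M₂ + x2 * x2 * M₁) * ((x1inv * (x1inv * p)) * (x2inv * q))
      ≈⟨ solve 9 (λ x1inv x2 x2inv x4 y1 M₂ M₁ p q →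
                    (x4 :* y1 :* M₂ :+ x2 :* x2 :* M₁) :* ((x1inv :* (x1inv :* p)) :* (x2inv :* q))
                 := x1inv :* x4 :* y1 :* (M₂ :* ((x1inv :* p) :* (x2inv :* q)))
                    :+ (x2 :* x2inv) :* (x1inv :* x2 :* (M₁ :* ((x1inv :* p) :* q))))
               ≈-refl x1inv x2 x2inv x4 y1 M₂ M₁ p q ⟩
    x1inv * x4 * y1 * (M₂ * ((x1inv * p) * (x2inv * q))) + (x2 * x2inv) * (x1inv * x2 * (M₁ * ((x1inv * p) * q)))
      ≈⟨ +-congˡ (≈-trans (*-congʳ x2x2inv≈1) (*-identityˡ _)) ⟩
    x1inv * x4 * y1 * (M₂ * ((x1inv * p) * (x2inv * q))) + x1inv * x2 * (M₁ * ((x1inv * p) * q))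
      ≡⟨ sym (cong₂ (λ a b → x1inv * x4 * y1 * a + x1inv * x2 * b) (z-offset 2 j) (z-offset 1 j)) ⟩
    x1inv * x4 * y1 * z (2 ℕ.+ d) + x1inv * x2 * z (1 ℕ.+ d) ∎
    where
    d  = j ℕ.+ j
    p  = pow x1inv j
    q  = pow x2inv j
    M₁ = matchingSum (1 ℕ.+ d)
    M₂ = matchingSum (2 ℕ.+ d)
    M₃ = matchingSum (3 ℕ.+ d)
    odd : isEven (suc d) ≡ false
    odd = cong not (isEven-double j)

  z-even : x1 * x1inv ≈ 1# → ∀ j → let d = j ℕ.+ j in
           z (4 ℕ.+ d) ≈ x2inv * x3 * z (3 ℕ.+ d) + x1 * x2inv * y1 * y2 * z (2 ℕ.+ d)
  z-even x1x1inv≈1 j = begin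
    z (4 ℕ.+ d)
      ≡⟨ z-offset 4 j ⟩
    M₄ * ((x1inv * (x1inv * p)) * (x2inv * (x2inv * q)))
      ≈⟨ *-congʳ (≈-trans (matchingSum-back (suc (suc d))) (+-cong (*-congʳ (backC-even (suc (suc d)) even))
                                                                (*-congʳ (backD-even (suc (suc d)) even)))) ⟩
    (x3 * M₃ + x1 * x1 * y2 * y1 * M₂) * ((x1inv * (x1inv * p)) * (x2inv * (x2inv * q)))
      ≈⟨ solve 10 (λ x1 x1inv x2inv x3 y1 y2 M₃ M₂ p q →
                     (x3 :* M₃ :+ x1 :* x1 :* y2 :* y1 :* M₂) :* ((x1inv :* (x1inv :* p)) :* (x2inv :* (x2inv :* q)))
                  := x2inv :* x3 :* (M₃ :* ((x1inv :* (x1inv :* p)) :* (x2inv :* q)))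
                     :+ (x1 :* x1inv) :* (x1 :* x2inv :* y1 :* y2 :* (M₂ :* ((x1inv :* p) :* (x2inv :* q)))))
               ≈-refl x1 x1inv x2inv x3 y1 y2 M₃ M₂ p q ⟩
    x2inv * x3 * (M₃ * ((x1inv * (x1inv * p)) * (x2inv * q)))
      + (x1 * x1inv) * (x1 * x2inv * y1 * y2 * (M₂ * ((x1inv * p) * (x2inv * q))))
      ≈⟨ +-congˡ (≈-trans (*-congʳ x1x1inv≈1) (*-identityˡ _)) ⟩
    x2inv * x3 * (M₃ * ((x1inv * (x1inv * p)) * (x2inv * q))) + x1 * x2inv * y1 * y2 * (M₂ * ((x1inv * p) * (x2inv * q)))
      ≡⟨ sym (cong₂ (λ a b → x2inv * x3 * a + x1 * x2inv * y1 * y2 * b) (z-offset 3 j) (z-offset 2 j)) ⟩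
    x2inv * x3 * z (3 ℕ.+ d) + x1 * x2inv * y1 * y2 * z (2 ℕ.+ d) ∎
    where
    d  = j ℕ.+ j
    p  = pow x1inv j
    q  = pow x2inv j
    M₂ = matchingSum (2 ℕ.+ d)
    M₃ = matchingSum (3 ℕ.+ d)
    M₄ = matchingSum (4 ℕ.+ d)
    even : isEven (suc (suc d)) ≡ true
    even = trans (Bool.not-involutive (isEven d)) (isEven-double j)

  Recurrences : ℕ → Set ℓ
  Recurrences d = (z (suc d) ≈ x1inv * x4 * y1 * z d + x1inv * x2 * z (suc d ℕ.∸ 2))
                × (z (suc (suc d)) ≈ x2inv * x3 * z (suc d) + x1 * x2inv * y1 * y2 * z d)

mainTheorem4 : {c ℓ : Level} (R : CommutativeRing c ℓ)
    → (x1 x1inv x2 x2inv x3 x4 y1 y2 : CommutativeRing.Carrier R)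
    → CommutativeRing._≈_ R (CommutativeRing._*_ R x1 x1inv) (CommutativeRing.1# R)
    → CommutativeRing._≈_ R (CommutativeRing._*_ R x2 x2inv) (CommutativeRing.1# R)
    → (k : ℕ) → 1 ≤ k
    → let open CommutativeRing R
          open Snake R x1 x1inv x2 x2inv x3 x4 y1 y2
      in (z (suc (2 ℕ.* k)) ≈ x1inv * x4 * y1 * z (2 ℕ.* k) + x1inv * x2 * z (suc (2 ℕ.* k) ℕ.∸ 2))
         × (z (suc (suc (2 ℕ.* k))) ≈ x2inv * x3 * z (suc (2 ℕ.* k)) + x1 * x2inv * y1 * y2 * z (2 ℕ.* k))
mainTheorem4 R x1 x1inv x2 x2inv x3 x4 y1 y2 x1x1inv≈1 x2x2inv≈1 (suc j) _ =
  subst Recurrences (sym (2*suc≡2+double j)) (z-odd x2x2inv≈1 j , z-even x1x1inv≈1 j)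
  where open Ladder R x1 x1inv x2 x2inv x3 x4 y1 y2
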